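{- Every 7-hyperantihole $G$ satisfies $\chi(G)\le\lfloor\frac{4}{3}\omega(G)\rfloor$.
   Context: A 7-hyperantihole is a graph whose vertex set is partitioned into seven nonempty cliques $X_1,\dots,X_7$ (indices in $\mathbb{Z}_7$) such that for each $i$, $X_i$ is anticomplete to $X_{i-1}\cup X_{i+1}$ and complete to $V(G)\setminus(X_{i-1}\cup X_i\cup X_{i+1})$. $\chi,\omega$ denote chromatic and clique number. -}

module Defs where

open import Data.Nat using (ℕ; zero; suc; _≤_; _*_)
open import Data.Fin using (Fin; zero; suc)
open import Data.Fin.Subset using (Subset; _∈_; ∣_∣)
open import Data.Product using (Σ; ∃; _×_; _,_)
open import Data.Sum using (_⊎_)
open import Relation.Nullary using (¬_)
open import Relation.Binary.PropositionalEquality using (_≡_; _≢_)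
open import Level using (0ℓ)

record Graph : Set₁ where
  field
    n     : ℕ
    Adj   : Fin n → Fin n → Set
    sym   : ∀ {u v} → Adj u v → Adj v u
    irrefl : ∀ {u} → ¬ Adj u u
open Graph public

next7 : Fin 7 → Fin 7
next7 zero = suc zero
next7 (suc zero) = suc (suc zero)
next7 (suc (suc zero)) = suc (suc (suc zero))
next7 (suc (suc (suc zero))) = suc (suc (suc (suc zero)))
next7 (suc (suc (suc (suc zero)))) = suc (suc (suc (suc (suc zero))))
next7 (suc (suc (suc (suc (suc zero))))) = suc (suc (suc (suc (suc (suc zero)))))
next7 (suc (suc (suc (suc (suc (suc zero)))))) = zero

-- X i = { v | part v ≡ i }.  The vertex set is partitioned into seven nonempty
-- cliques X₀..X₆ (indices in ℤ₇); X i is anticomplete to X (i-1) ∪ X (i+1)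
-- and complete to all other parts.
record IsHyperantihole7 (G : Graph) (part : Fin (n G) → Fin 7) : Set where
  field
    nonempty     : ∀ i → ∃ λ v → part v ≡ i
    clique       : ∀ u v → part u ≡ part v → u ≢ v → Adj G u v
    anticomplete : ∀ u v → part v ≡ next7 (part u) → ¬ Adj G u v
    complete     : ∀ u v → part u ≢ part v → part v ≢ next7 (part u)
                   → part u ≢ next7 (part v) → Adj G u v

Is7Hyperantihole : Graph → Set
Is7Hyperantihole G = ∃ λ part → IsHyperantihole7 G part

IsClique : (G : Graph) → Subset (n G) → Set
IsClique G S = ∀ u v → u ∈ S → v ∈ S → u ≢ v → Adj G u v

IsCliqueNumber : Graph → ℕ → Set
IsCliqueNumber G w =
  (∃ λ S → IsClique G S × ∣ S ∣ ≡ w) × (∀ S → IsClique G S → ∣ S ∣ ≤ w)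

-- proper colourings; χ(G) ≤ k  iff  a proper k-colouring exists
IsProperColouring : (G : Graph) (k : ℕ) → (Fin (n G) → Fin k) → Set
IsProperColouring G k c = ∀ u v → Adj G u v → c u ≢ c v

Colourable : Graph → ℕ → Set
Colourable G k = ∃ λ c → IsProperColouring G k c

-- A 7-hyperantihole is the antihole C̄₇ with each vertex i blown up into a
-- clique X i.  The sets X j ∪ X (j+2) ∪ X (j+4) are cliques, and every point
-- of ℤ₇ lies on three of these seven triangles.  So for the sizes a i = ∣ X i ∣
-- and k = ⌊4ω/3⌋ every triangle weighs at most ω ≤ k, and 3 Σ a ≤ 7ω < 3 (2k+1),
-- i.e. Σ a ≤ 2k.  Weights with these two bounds are k-colourable, by induction
-- on k.  If some pair i, i+1 is nonempty and {i+2, i+4, i+6}, the only triangle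
-- missing it, weighs less than k, one vertex of X i and one of X (i+1) share a
-- fresh colour.  Otherwise a nonempty pair would propagate around the cycle and
-- make all seven triangles weigh k, giving 7k ≤ 3 Σ a ≤ 6k; so no two
-- consecutive parts are nonempty, the support lies in one triangle, Σ a ≤ k, and
-- a single vertex takes the fresh colour.

module Submission where

open import Data.Empty using (⊥; ⊥-elim)
open import Data.Fin using (Fin; zero; suc; toℕ; fromℕ<)
open import Data.Fin.Patterns using (0F; 1F; 2F; 3F; 4F; 5F; 6F)
open import Data.Fin.Properties using (all?; any?; toℕ-fromℕ<) renaming (_≟_ to _≟ᶠ_)
open import Data.Fin.Subset using (Subset; inside; outside; _∈_; ∣_∣; _∪_; _∩_; Empty)
open import Data.Fin.Subset.Properties using (x∈p∪q⁻; x∈p∩q⁻; x∈p∩q⁺)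
open import Data.Nat using (ℕ; zero; suc; _+_; _*_; _∸_; _≤_; _<_; z≤n; s≤s; s≤s⁻¹; _<?_)
  renaming (_≟_ to _≟ⁿ_)
open import Data.Nat.DivMod using (_/_; m≡m%n+[m/n]*n; m%n<n; m*n/n≡m; /-monoˡ-≤)
open import Data.Nat.GeneralisedArithmetic using (iterate)
open import Data.Nat.Properties
open import Algebra.Properties.CommutativeMonoid.Sum +-0-commutativeMonoid
  using (sum; ∑-distrib-+; sum-cong-≗)
open import Data.Nat.Tactic.RingSolver using (solve-∀)
open import Data.Product using (∃; _×_; _,_; proj₁; proj₂; map₁)
open import Data.Sum using (inj₁; inj₂)
open import Data.Vec using ([]; _∷_; tabulate; here; there)
open import Data.Vec.Functional using (Vector)
open import Data.Vec.Properties using (lookup∘tabulate; []=⇒lookup; lookup⇒[]=)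
open import Function using (_∘_)
open import Relation.Binary using (DecidableEquality)
open import Relation.Binary.PropositionalEquality
  using (_≡_; _≢_; refl; sym; trans; cong; subst; subst₂; module ≡-Reasoning)
open import Relation.Nullary using (¬_; Dec; yes; no; ¬?; does)
open import Relation.Nullary.Decidable using (from-yes; dec-true; _×-dec_; _→-dec_)

open import Defs hiding (sym)

sum-mono-≤ : ∀ {n} {f g : Vector ℕ n} → (∀ i → f i ≤ g i) → sum f ≤ sum g
sum-mono-≤ {zero}  _   = z≤n
sum-mono-≤ {suc n} f≤g = +-mono-≤ (f≤g zero) (sum-mono-≤ (f≤g ∘ suc))

rotate-sum₃ : ∀ x y z → x + (y + (z + 0)) ≡ y + (z + (x + 0))
rotate-sum₃ = solve-∀

∸<⇒0< : ∀ {m n} → m ∸ n < m → 0 < n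
∸<⇒0< {n = zero}  m<m = ⊥-elim (<-irrefl refl m<m)
∸<⇒0< {n = suc _} _   = s≤s z≤n

cancel-≤ : ∀ {x n y k} → x + n ≡ y → y ≤ n + k → x ≤ k
cancel-≤ {x} {n} {y} {k} x+n≡y y≤n+k =
  +-cancelʳ-≤ n x k (subst₂ _≤_ (sym x+n≡y) (+-comm n k) y≤n+k)

not-positive : ∀ {x} → ¬ 0 < x → x ≡ 0
not-positive x≯0 = n≤0⇒n≡0 (≮⇒≥ x≯0)

_⊝_ : ∀ {I : Set} → (I → ℕ) → (I → ℕ) → I → ℕ
(a ⊝ δ) i = a i ∸ δ i

sum-⊝ : ∀ {n} {a δ : Vector ℕ n} → (∀ i → δ i ≤ a i) → sum (a ⊝ δ) + sum δ ≡ sum a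
sum-⊝ {a = a} {δ} δ≤a = begin
  sum (a ⊝ δ) + sum δ          ≡⟨ sym (∑-distrib-+ (a ⊝ δ) δ) ⟩
  sum (λ i → (a ⊝ δ) i + δ i)  ≡⟨ sum-cong-≗ (λ i → m∸n+n≡m (δ≤a i)) ⟩
  sum a                        ∎
  where open ≡-Reasoning

rank : ∀ {n} → Subset n → Fin n → ℕ
rank (_       ∷ _) zero    = 0
rank (inside  ∷ p) (suc v) = suc (rank p v)
rank (outside ∷ p) (suc v) = rank p v

rank<∣p∣ : ∀ {n} {p : Subset n} {v} → v ∈ p → rank p v < ∣ p ∣
rank<∣p∣                   here        = s≤s z≤n
rank<∣p∣ {p = inside  ∷ p} (there v∈p) = s≤s (rank<∣p∣ v∈p)
rank<∣p∣ {p = outside ∷ p} (there v∈p) = rank<∣p∣ v∈p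

rank-injective : ∀ {n} {p : Subset n} {u v} → u ∈ p → v ∈ p → rank p u ≡ rank p v → u ≡ v
rank-injective                   here        here        _  = refl
rank-injective                   here        (there _)   ()
rank-injective                   (there _)   here        ()
rank-injective {p = inside  ∷ p} (there u∈p) (there v∈p) eq =
  cong suc (rank-injective u∈p v∈p (suc-injective eq))
rank-injective {p = outside ∷ p} (there u∈p) (there v∈p) eq =
  cong suc (rank-injective u∈p v∈p eq)

∣p∪q∣≡∣p∣+∣q∣ : ∀ {n} (p q : Subset n) → Empty (p ∩ q) → ∣ p ∪ q ∣ ≡ ∣ p ∣ + ∣ q ∣
∣p∪q∣≡∣p∣+∣q∣ []            []            _     = refl
∣p∪q∣≡∣p∣+∣q∣ (inside  ∷ p) (inside  ∷ q) empty = ⊥-elim (empty (zero , here))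
∣p∪q∣≡∣p∣+∣q∣ (inside  ∷ p) (outside ∷ q) empty =
  cong suc (∣p∪q∣≡∣p∣+∣q∣ p q (λ (v , v∈p∩q) → empty (suc v , there v∈p∩q)))
∣p∪q∣≡∣p∣+∣q∣ (outside ∷ p) (inside  ∷ q) empty =
  trans (cong suc (∣p∪q∣≡∣p∣+∣q∣ p q (λ (v , v∈p∩q) → empty (suc v , there v∈p∩q))))
        (sym (+-suc ∣ p ∣ ∣ q ∣))
∣p∪q∣≡∣p∣+∣q∣ (outside ∷ p) (outside ∷ q) empty =
  ∣p∪q∣≡∣p∣+∣q∣ p q (λ (v , v∈p∩q) → empty (suc v , there v∈p∩q))

module _ {A : Set} (_≟_ : DecidableEquality A) {n} (f : Fin n → A) where

  fibre : A → Subset n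
  fibre x = tabulate (λ v → does (f v ≟ x))

  ∈-fibre⁺ : ∀ {v x} → f v ≡ x → v ∈ fibre x
  ∈-fibre⁺ {v} {x} fv≡x =
    lookup⇒[]= v _ (trans (lookup∘tabulate _ v) (dec-true (f v ≟ x) fv≡x))

  ∈-fibre⁻ : ∀ {v x} → v ∈ fibre x → f v ≡ x
  ∈-fibre⁻ {v} {x} v∈ with f v ≟ x | trans (sym (lookup∘tabulate _ v)) ([]=⇒lookup v∈)
  ... | yes fv≡x | _  = fv≡x
  ... | no  _    | ()

  fibres-disjoint : ∀ {x y} → x ≢ y → Empty (fibre x ∩ fibre y)
  fibres-disjoint x≢y (v , v∈) with x∈p∩q⁻ (fibre _) (fibre _) v∈
  ... | v∈x , v∈y = x≢y (trans (sym (∈-fibre⁻ v∈x)) (∈-fibre⁻ v∈y))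

-- Weighted colourings

-- A proper k-colouring of the graph obtained from the relation R by
-- replacing each i by a clique of size a i: colour i r is the colour of
-- the r-th vertex of that clique.
record WeightedColouring {I : Set} (R : I → I → Set) (a : I → ℕ) (k : ℕ) : Set where
  field
    colour    : I → ℕ → ℕ
    colour<k  : ∀ {i r} → r < a i → colour i r < k
    injective : ∀ {i r s} → r < a i → s < a i → colour i r ≡ colour i s → r ≡ s
    apart     : ∀ {i j r s} → R i j → r < a i → s < a j → colour i r ≢ colour j s

module _ {I : Set} {R : I → I → Set} where

  emptyColouring : ∀ {a : I → ℕ} {k} → (∀ i → a i ≡ 0) → WeightedColouring R a k
  emptyColouring {a} a≡0 = record
    { colour    = λ _ _ → 0
    ; colour<k  = λ r<a → ⊥-elim (nothing r<a)
    ; injective = λ r<a _ _ → ⊥-elim (nothing r<a)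
    ; apart     = λ _ r<a _ _ → nothing r<a
    }
    where
    nothing : ∀ {i r} → r < a i → ⊥
    nothing {i} r<a = n≮0 (subst (_ <_) (a≡0 i) r<a)

  reindex : ∀ {J : Set} {S : J → J → Set} {a : I → ℕ} {b : J → ℕ} {k}
            (σ : I → J) → (∀ i → a i ≤ b (σ i)) → (∀ {i j} → R i j → S (σ i) (σ j)) →
            WeightedColouring S b k → WeightedColouring R a k
  reindex {a = a} σ a≤b hom c = record
    { colour    = colour ∘ σ
    ; colour<k  = colour<k ∘ lift
    ; injective = λ r<a s<a → injective (lift r<a) (lift s<a)
    ; apart     = λ Rij r<a s<a → apart (hom Rij) (lift r<a) (lift s<a)
    }
    where
    open WeightedColouring c
    lift : ∀ {i r} → r < a i → r < _
    lift {i} r<a = <-≤-trans r<a (a≤b i)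

-- The last vertex of every clique i with δ i = 1 is removed; these vertices
-- form an independent set, so they can all take the new colour k.
module _ {I : Set} {R : I → I → Set} {a : I → ℕ} {k : ℕ}
         (δ : I → ℕ) (δ≤1 : ∀ i → δ i ≤ 1)
         (δ-independent : ∀ {i j} → R i j → 0 < δ i → 0 < δ j → ⊥)
         (c : WeightedColouring R (a ⊝ δ) k) where

  open WeightedColouring c

  private
    colour⁺ : I → ℕ → ℕ
    colour⁺ i r with r ≟ⁿ (a ⊝ δ) i
    ... | yes _ = k
    ... | no  _ = colour i r

    colour⁺-new : ∀ {i r} → r ≡ (a ⊝ δ) i → colour⁺ i r ≡ k
    colour⁺-new {i} {r} r≡ with r ≟ⁿ (a ⊝ δ) i
    ... | yes _  = refl
    ... | no  r≢ = ⊥-elim (r≢ r≡)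

    colour⁺-old : ∀ {i r} → r ≢ (a ⊝ δ) i → colour⁺ i r ≡ colour i r
    colour⁺-old {i} {r} r≢ with r ≟ⁿ (a ⊝ δ) i
    ... | yes r≡ = ⊥-elim (r≢ r≡)
    ... | no  _  = refl

    data Slot (i : I) (r : ℕ) : Set where
      new : r ≡ (a ⊝ δ) i → 0 < δ i → colour⁺ i r ≡ k → Slot i r
      old : r < (a ⊝ δ) i → colour⁺ i r ≡ colour i r → Slot i r

    below-a⊝δ : ∀ {i r} → r < a i → r ≤ (a ⊝ δ) i
    below-a⊝δ {i} r<a =
      s≤s⁻¹ (≤-trans r<a (≤-trans (m≤n+m∸n (a i) (δ i)) (+-monoˡ-≤ _ (δ≤1 i))))

    slot : ∀ {i r} → r < a i → Slot i r
    slot {i} r<a with m≤n⇒m<n∨m≡n (below-a⊝δ r<a)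
    ... | inj₁ r<a′ = old r<a′ (colour⁺-old (<⇒≢ r<a′))
    ... | inj₂ r≡a′ = new r≡a′ (∸<⇒0< (subst (_< a i) r≡a′ r<a)) (colour⁺-new r≡a′)

    new≢old : ∀ {j s} → s < (a ⊝ δ) j → k ≢ colour j s
    new≢old s<a′ k≡ = <-irrefl (sym k≡) (colour<k s<a′)

    colour⁺<1+k : ∀ {i r} → r < a i → colour⁺ i r < suc k
    colour⁺<1+k r<a with slot r<a
    ... | new _ _ eq  = subst (_< suc k) (sym eq) ≤-refl
    ... | old r<a′ eq = subst (_< suc k) (sym eq) (m<n⇒m<1+n (colour<k r<a′))

    colour⁺-injective : ∀ {i r s} → r < a i → s < a i → colour⁺ i r ≡ colour⁺ i s → r ≡ s
    colour⁺-injective r<a s<a eq with slot r<a | slot s<a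
    ... | new r≡ _ _   | new s≡ _ _   = trans r≡ (sym s≡)
    ... | new _ _ eqr  | old s<a′ eqs = ⊥-elim (new≢old s<a′ (trans (sym eqr) (trans eq eqs)))
    ... | old r<a′ eqr | new _ _ eqs  = ⊥-elim (new≢old r<a′ (trans (sym eqs) (trans (sym eq) eqr)))
    ... | old r<a′ eqr | old s<a′ eqs = injective r<a′ s<a′ (trans (sym eqr) (trans eq eqs))

    colour⁺-apart : ∀ {i j r s} → R i j → r < a i → s < a j → colour⁺ i r ≢ colour⁺ j s
    colour⁺-apart Rij r<a s<a eq with slot r<a | slot s<a
    ... | new _ δi>0 _ | new _ δj>0 _  = δ-independent Rij δi>0 δj>0
    ... | new _ _ eqr  | old s<a′ eqs = new≢old s<a′ (trans (sym eqr) (trans eq eqs))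
    ... | old r<a′ eqr | new _ _ eqs  = new≢old r<a′ (trans (sym eqs) (trans (sym eq) eqr))
    ... | old r<a′ eqr | old s<a′ eqs = apart Rij r<a′ s<a′ (trans (sym eqr) (trans eq eqs))

  extend : WeightedColouring R a (suc k)
  extend = record
    { colour    = colour⁺
    ; colour<k  = colour⁺<1+k
    ; injective = colour⁺-injective
    ; apart     = colour⁺-apart
    }

module _ (G : Graph) {I : Set} (_≟_ : DecidableEquality I) (part : Fin (n G) → I) where

  partSize : I → ℕ
  partSize i = ∣ fibre _≟_ part i ∣

  blowup-colourable : ∀ {R : I → I → Set} {k} →
                      (∀ {u v} → Adj G u v → part u ≢ part v → R (part u) (part v)) →
                      WeightedColouring R partSize k → Colourable G k
  blowup-colourable {R} {k} adjacent-parts c = vertexColour , proper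
    where
    open WeightedColouring c

    index< : ∀ {v i} → part v ≡ i → rank (fibre _≟_ part i) v < partSize i
    index< pv≡i = rank<∣p∣ (∈-fibre⁺ _≟_ part pv≡i)

    vertexColour : Fin (n G) → Fin k
    vertexColour v = fromℕ< (colour<k (index< {v} refl))

    separated : ∀ {u v i j} → Adj G u v → part u ≡ i → part v ≡ j →
                colour i (rank (fibre _≟_ part i) u) ≢ colour j (rank (fibre _≟_ part j) v)
    separated {u} {v} {i} {j} uv pu pv eq with i ≟ j
    ... | yes refl = irrefl G (subst (Adj G u) (sym u≡v) uv)
      where
      u≡v : u ≡ v
      u≡v = rank-injective (∈-fibre⁺ _≟_ part pu) (∈-fibre⁺ _≟_ part pv)
                           (injective (index< pu) (index< pv) eq)
    ... | no i≢j = apart (subst₂ R pu pv (adjacent-parts uv parts≢)) (index< pu) (index< pv) eq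
      where
      parts≢ : part u ≢ part v
      parts≢ pu≡pv = i≢j (trans (sym pu) (trans pu≡pv pv))

    proper : IsProperColouring G k vertexColour
    proper u v uv eq = separated uv refl refl
      (trans (sym (toℕ-fromℕ< _)) (trans (cong toℕ eq) (toℕ-fromℕ< _)))

-- The antihole on ℤ₇

prev7 : Fin 7 → Fin 7
prev7 0F = 6F
prev7 1F = 0F
prev7 2F = 1F
prev7 3F = 2F
prev7 4F = 3F
prev7 5F = 4F
prev7 6F = 5F

Distant : Fin 7 → Fin 7 → Set
Distant i j = i ≢ j × j ≢ next7 i × i ≢ next7 j

distant? : ∀ i j → Dec (Distant i j)
distant? i j = ¬? (i ≟ᶠ j) ×-dec ¬? (j ≟ᶠ next7 i) ×-dec ¬? (i ≟ᶠ next7 j)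

-- The triangles {j, j+2, j+4} are the maximum cliques of the antihole.
corner : Fin 7 → Fin 3 → Fin 7
corner j 0F = j
corner j 1F = next7 (next7 j)
corner j 2F = next7 (next7 (next7 (next7 j)))

next7-prev7 : ∀ i → next7 (prev7 i) ≡ i
next7-prev7 = from-yes (all? λ i → next7 (prev7 i) ≟ᶠ i)

next7⁷ : ∀ i → next7 (next7 (next7 (next7 (next7 (next7 (next7 i)))))) ≡ i
next7⁷ = from-yes (all? λ i → next7 (next7 (next7 (next7 (next7 (next7 (next7 i)))))) ≟ᶠ i)

iterate-next7-0F : ∀ j → iterate next7 0F (toℕ j) ≡ j
iterate-next7-0F = from-yes (all? λ j → iterate next7 0F (toℕ j) ≟ᶠ j)

distant-prev7 : ∀ i j → Distant i j → Distant (prev7 i) (prev7 j)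
distant-prev7 = from-yes (all? λ i → all? λ j → distant? i j →-dec distant? (prev7 i) (prev7 j))

corners-distant : ∀ j c c′ → c ≢ c′ → Distant (corner j c) (corner j c′)
corners-distant = from-yes (all? λ j → all? λ c → all? λ c′ →
  ¬? (c ≟ᶠ c′) →-dec distant? (corner j c) (corner j c′))

reach : ∀ i j → ∃ λ (p : Fin 7) → next7 (next7 (iterate next7 i (toℕ p))) ≡ j
reach = from-yes (all? λ i → all? λ j → any? λ (p : Fin 7) → next7 (next7 (iterate next7 i (toℕ p))) ≟ᶠ j)

Weights : Set
Weights = Fin 7 → ℕ

triangleWeight : Weights → Fin 7 → ℕ
triangleWeight a j = sum (a ∘ corner j)

weight≤triangleWeight : ∀ a j → a j ≤ triangleWeight a j
weight≤triangleWeight a j = m≤m+n (a j) _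

rotate : Weights → Weights
rotate a = a ∘ next7

rotateBy : ℕ → Weights → Weights
rotateBy p a i = a (iterate next7 i p)

sum-rotate : ∀ a → sum (rotate a) ≡ sum a
sum-rotate a = shift (a 0F) (a 1F) (a 2F) (a 3F) (a 4F) (a 5F) (a 6F)
  where
  shift : ∀ x₀ x₁ x₂ x₃ x₄ x₅ x₆ →
          x₁ + (x₂ + (x₃ + (x₄ + (x₅ + (x₆ + (x₀ + 0)))))) ≡
          x₀ + (x₁ + (x₂ + (x₃ + (x₄ + (x₅ + (x₆ + 0))))))
  shift = solve-∀

-- Every point lies on exactly three of the seven triangles.
sum-triangleWeight : ∀ a → sum (triangleWeight a) ≡ 3 * sum a
sum-triangleWeight a = count (a 0F) (a 1F) (a 2F) (a 3F) (a 4F) (a 5F) (a 6F)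
  where
  count : ∀ x₀ x₁ x₂ x₃ x₄ x₅ x₆ →
          (x₀ + (x₂ + (x₄ + 0))) + ((x₁ + (x₃ + (x₅ + 0))) + ((x₂ + (x₄ + (x₆ + 0))) +
          ((x₃ + (x₅ + (x₀ + 0))) + ((x₄ + (x₆ + (x₁ + 0))) + ((x₅ + (x₀ + (x₂ + 0))) +
          ((x₆ + (x₁ + (x₃ + 0))) + 0)))))) ≡
          3 * (x₀ + (x₁ + (x₂ + (x₃ + (x₄ + (x₅ + (x₆ + 0)))))))
  count = solve-∀

module _ (Q : Weights → Fin 7 → Set) where

  rotateBy⁺ : (∀ {a j} → Q a (next7 j) → Q (rotate a) j) →
              ∀ p {a j} → Q a (iterate next7 j p) → Q (rotateBy p a) j
  rotateBy⁺ step zero    q = q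
  rotateBy⁺ step (suc p) q = step (rotateBy⁺ step p q)

  rotateBy⁻ : (∀ {a j} → Q (rotate a) j → Q a (next7 j)) →
              ∀ p {a j} → Q (rotateBy p a) j → Q a (iterate next7 j p)
  rotateBy⁻ step zero    q = q
  rotateBy⁻ step (suc p) q = rotateBy⁻ step p (step q)

wlog-0F : (P : Weights → Set) → (∀ {a} → P (rotate a) → P a) →
          (Q : Weights → Fin 7 → Set) → (∀ {a j} → Q a (next7 j) → Q (rotate a) j) →
          (∀ {a} → Q a 0F → P a) → ∀ {a} j → Q a j → P a
wlog-0F P P-unrotate Q Q-rotate P₀ {a} j q =
  rotateBy⁻ (λ b _ → P b) P-unrotate (toℕ j) {j = 0F}
    (P₀ (rotateBy⁺ Q Q-rotate (toℕ j) (subst (Q a) (sym (iterate-next7-0F j)) q)))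

triangleWeight-⊝ : ∀ {a δ} → (∀ i → δ i ≤ a i) → ∀ j →
                   triangleWeight (a ⊝ δ) j + triangleWeight δ j ≡ triangleWeight a j
triangleWeight-⊝ {a} {δ} δ≤a j = sum-⊝ {a = a ∘ corner j} {δ = δ ∘ corner j} (δ≤a ∘ corner j)

triangleWeight-0F≤sum : ∀ a → triangleWeight a 0F ≤ sum a
triangleWeight-0F≤sum a =
  subst (triangleWeight a 0F ≤_) (sym (split (a 0F) (a 1F) (a 2F) (a 3F) (a 4F) (a 5F) (a 6F))) (m≤m+n _ _)
  where
  split : ∀ x₀ x₁ x₂ x₃ x₄ x₅ x₆ →
          x₀ + (x₁ + (x₂ + (x₃ + (x₄ + (x₅ + (x₆ + 0)))))) ≡
          (x₀ + (x₂ + (x₄ + 0))) + (x₁ + x₃ + x₅ + x₆)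
  split = solve-∀

triangleWeight≤sum : ∀ a j → triangleWeight a j ≤ sum a
triangleWeight≤sum a j =
  subst (λ j → triangleWeight a j ≤ sum a) (iterate-next7-0F j)
    (rotateBy⁻ (λ b j → triangleWeight b j ≤ sum b) (λ {b} → unrotate-sum {b}) (toℕ j) {a} {0F}
               (triangleWeight-0F≤sum (rotateBy (toℕ j) a)))
  where
  unrotate-sum : ∀ {b j} → triangleWeight (rotate b) j ≤ sum (rotate b) → triangleWeight b (next7 j) ≤ sum b
  unrotate-sum {b} {j} = subst (triangleWeight b (next7 j) ≤_) (sum-rotate b)

-- Colouring admissible weights

record Admissible (a : Weights) (k : ℕ) : Set where
  field
    triangle≤ : ∀ j → triangleWeight a j ≤ k
    sum≤      : sum a ≤ k + k
open Admissible

admissible-rotate : ∀ {a k} → Admissible a k → Admissible (rotate a) k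
admissible-rotate {a} {k} adm = record
  { triangle≤ = triangle≤ adm ∘ next7
  ; sum≤      = subst (_≤ k + k) (sym (sum-rotate a)) (sum≤ adm)
  }

admissible-if-sum≤ : ∀ {a k} → sum a ≤ k → Admissible a k
admissible-if-sum≤ {a} {k} a≤k = record
  { triangle≤ = λ j → ≤-trans (triangleWeight≤sum a j) a≤k
  ; sum≤      = ≤-trans a≤k (m≤m+n k k)
  }

unrotate : ∀ {a k} → WeightedColouring Distant (rotate a) k → WeightedColouring Distant a k
unrotate {a} = reindex prev7 (λ i → ≤-reflexive (cong a (sym (next7-prev7 i)))) (distant-prev7 _ _)

PositivePair : Weights → Fin 7 → Set
PositivePair a i = 0 < a i × 0 < a (next7 i)

-- The triangle at i + 2 is the only one avoiding both i and i + 1, so this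
-- is what lets the pair {i, i + 1} take a colour of its own.
ReduciblePair : ℕ → Weights → Fin 7 → Set
ReduciblePair k a i = PositivePair a i × triangleWeight a (next7 (next7 i)) < k

reduciblePair? : ∀ k a i → Dec (ReduciblePair k a i)
reduciblePair? k a i = ((0 <? a i) ×-dec (0 <? a (next7 i))) ×-dec (triangleWeight a (next7 (next7 i)) <? k)

edge₀ : Weights
edge₀ 0F            = 1
edge₀ 1F            = 1
edge₀ (suc (suc _)) = 0

edge₀≤1 : ∀ i → edge₀ i ≤ 1
edge₀≤1 0F            = ≤-refl
edge₀≤1 1F            = ≤-refl
edge₀≤1 (suc (suc _)) = z≤n

edge₀-independent : ∀ {i j} → Distant i j → 0 < edge₀ i → 0 < edge₀ j → ⊥
edge₀-independent {0F} {0F} (i≢j , _)         _ _ = i≢j refl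
edge₀-independent {0F} {1F} (_ , j≢i⁺ , _)    _ _ = j≢i⁺ refl
edge₀-independent {1F} {0F} (_ , _ , i≢j⁺)    _ _ = i≢j⁺ refl
edge₀-independent {1F} {1F} (i≢j , _)         _ _ = i≢j refl
edge₀-independent {suc (suc _)} _ ()
edge₀-independent {_} {suc (suc _)} _ _ ()

edge₀-triangle : ∀ j → j ≢ 2F → triangleWeight edge₀ j ≡ 1
edge₀-triangle = from-yes (all? λ j → ¬? (j ≟ᶠ 2F) →-dec (triangleWeight edge₀ j ≟ⁿ 1))

pair-admissible₀ : ∀ {a k} → Admissible a (suc k) → ReduciblePair (suc k) a 0F → Admissible (a ⊝ edge₀) k
pair-admissible₀ {a} {k} adm ((a₀>0 , a₁>0) , T₂<1+k) = record
  { triangle≤ = triangle≤k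
  ; sum≤      = cancel-≤ (sum-⊝ edge₀≤a) (subst (sum a ≤_) (cong suc (+-suc k k)) (sum≤ adm))
  }
  where
  edge₀≤a : ∀ i → edge₀ i ≤ a i
  edge₀≤a 0F            = a₀>0
  edge₀≤a 1F            = a₁>0
  edge₀≤a (suc (suc _)) = z≤n

  triangle≤k : ∀ j → triangleWeight (a ⊝ edge₀) j ≤ k
  triangle≤k j with j ≟ᶠ 2F
  ... | yes refl = s≤s⁻¹ T₂<1+k
  ... | no  j≢2  = cancel-≤ (trans (cong (triangleWeight (a ⊝ edge₀) j +_) (sym (edge₀-triangle j j≢2)))
                                   (triangleWeight-⊝ edge₀≤a j))
                            (triangle≤ adm j)

colour-pair : ∀ {k} → (∀ {b} → Admissible b k → WeightedColouring Distant b k) →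
              ∀ {a} j → Admissible a (suc k) → ReduciblePair (suc k) a j → WeightedColouring Distant a (suc k)
colour-pair {k} colourable j adm red =
  wlog-0F (λ b → WeightedColouring Distant b (suc k)) unrotate
          (λ b j → Admissible b (suc k) × ReduciblePair (suc k) b j) (map₁ admissible-rotate)
          (λ (adm , red) → extend edge₀ edge₀≤1 edge₀-independent (colourable (pair-admissible₀ adm red)))
          j (adm , red)

NoReduciblePair : ℕ → Weights → Set
NoReduciblePair k a = ∀ i → ¬ ReduciblePair k a i

spread : ∀ {a k i} → Admissible a k → NoReduciblePair k a → PositivePair a i →
         k ≤ triangleWeight a (next7 (next7 i)) × PositivePair a (next7 i)
spread {a} {k} {i} adm none pair@(_ , a₁>0) = tight , a₁>0 , <-≤-trans a₁>0 a₁≤a₂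
  where
  i₁ i₂ i₄ i₆ : Fin 7
  i₁ = next7 i
  i₂ = next7 i₁
  i₄ = next7 (next7 i₂)
  i₆ = next7 (next7 i₄)

  tight : k ≤ triangleWeight a i₂
  tight = ≮⇒≥ (λ T<k → none i (pair , T<k))

  a₁≤a₂ : a i₁ ≤ a i₂
  a₁≤a₂ = +-cancelʳ-≤ (a i₄ + (a i₆ + 0)) (a i₁) (a i₂) (begin
    a i₁ + (a i₄ + (a i₆ + 0))  ≡⟨ rotate-sum₃ (a i₁) (a i₄) (a i₆) ⟩
    a i₄ + (a i₆ + (a i₁ + 0))  ≡⟨ cong (λ x → a i₄ + (a i₆ + (a x + 0))) (sym (next7⁷ i₁)) ⟩
    triangleWeight a i₄         ≤⟨ triangle≤ adm i₄ ⟩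
    k                           ≤⟨ tight ⟩
    triangleWeight a i₂         ∎)
    where open ≤-Reasoning

positive-pairs : ∀ {a k i} → Admissible a k → NoReduciblePair k a → PositivePair a i →
                 ∀ p → PositivePair a (iterate next7 i p)
positive-pairs adm none pair zero    = pair
positive-pairs adm none pair (suc p) = positive-pairs adm none (proj₂ (spread adm none pair)) p

-- Otherwise every triangle would be tight and 7k ≤ 3 · sum ≤ 6k.
no-positive-pair : ∀ {a k} → Admissible a k → NoReduciblePair k a → ∀ i → ¬ PositivePair a i
no-positive-pair {a} {k} adm none i pair@(aᵢ>0 , _) =
  n≮0 (<-≤-trans aᵢ>0 (≤-trans (weight≤triangleWeight a i) (subst (triangleWeight a i ≤_) k≡0 (triangle≤ adm i))))
  where
  tight : ∀ j → k ≤ triangleWeight a j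
  tight j with reach i j
  ... | p , refl = proj₁ (spread adm none (positive-pairs adm none pair (toℕ p)))

  k≡0 : k ≡ 0
  k≡0 = n≤0⇒n≡0 (+-cancelʳ-≤ (3 * (k + k)) k 0 (begin
    k + 3 * (k + k)          ≡⟨ seven k ⟩
    7 * k                    ≤⟨ sum-mono-≤ tight ⟩
    sum (triangleWeight a)   ≡⟨ sum-triangleWeight a ⟩
    3 * sum a                ≤⟨ *-monoʳ-≤ 3 (sum≤ adm) ⟩
    3 * (k + k)              ∎))
    where
    open ≤-Reasoning
    seven : ∀ k → k + 3 * (k + k) ≡ 7 * k
    seven = solve-∀

sum-on-035 : ∀ a → a 1F ≡ 0 → a 2F ≡ 0 → a 4F ≡ 0 → a 6F ≡ 0 → sum a ≡ triangleWeight a 3F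
sum-on-035 a a₁≡0 a₂≡0 a₄≡0 a₆≡0 rewrite a₁≡0 | a₂≡0 | a₄≡0 | a₆≡0 = rotate-sum₃ (a 0F) (a 3F) (a 5F)

sum-on-024 : ∀ a → a 1F ≡ 0 → a 3F ≡ 0 → a 5F ≡ 0 → a 6F ≡ 0 → sum a ≡ triangleWeight a 0F
sum-on-024 a a₁≡0 a₃≡0 a₅≡0 a₆≡0 rewrite a₁≡0 | a₃≡0 | a₅≡0 | a₆≡0 = refl

sum-on-502 : ∀ a → a 1F ≡ 0 → a 3F ≡ 0 → a 4F ≡ 0 → a 6F ≡ 0 → sum a ≡ triangleWeight a 5F
sum-on-502 a a₁≡0 a₃≡0 a₄≡0 a₆≡0 rewrite a₁≡0 | a₃≡0 | a₄≡0 | a₆≡0 = sym (rotate-sum₃ (a 5F) (a 0F) (a 2F))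

module _ {a : Weights} (no-pair : ∀ i → ¬ PositivePair a i) where

  zero-after : ∀ {i} → 0 < a i → a (next7 i) ≡ 0
  zero-after {i} aᵢ>0 = not-positive (λ a>0 → no-pair i (aᵢ>0 , a>0))

  zero-before : ∀ {i} → 0 < a (next7 i) → a i ≡ 0
  zero-before {i} a>0 = not-positive (λ aᵢ>0 → no-pair i (aᵢ>0 , a>0))

  -- Since no two consecutive points carry weight, the support of a lies in
  -- one of the triangles {3, 5, 0}, {0, 2, 4}, {5, 0, 2} through 0.
  sum≤-at-0F : ∀ {k} → (∀ j → triangleWeight a j ≤ k) → 0 < a 0F → sum a ≤ k
  sum≤-at-0F {k} T≤k a₀>0 = on-support (zero-after a₀>0) (zero-before a₀>0)
    where
    on-support : a 1F ≡ 0 → a 6F ≡ 0 → sum a ≤ k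
    on-support a₁≡0 a₆≡0 with 0 <? a 3F | 0 <? a 4F
    ... | yes a₃>0 | _ =
      subst (_≤ k) (sym (sum-on-035 a a₁≡0 (zero-before a₃>0) (zero-after a₃>0) a₆≡0)) (T≤k 3F)
    ... | no a₃≯0 | yes a₄>0 =
      subst (_≤ k) (sym (sum-on-024 a a₁≡0 (not-positive a₃≯0) (zero-after a₄>0) a₆≡0)) (T≤k 0F)
    ... | no a₃≯0 | no a₄≯0 =
      subst (_≤ k) (sym (sum-on-502 a a₁≡0 (not-positive a₃≯0) (not-positive a₄≯0) a₆≡0)) (T≤k 5F)

point₀ : Weights
point₀ 0F      = 1
point₀ (suc _) = 0

point₀≤1 : ∀ i → point₀ i ≤ 1
point₀≤1 0F      = ≤-refl
point₀≤1 (suc _) = z≤n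

point₀-independent : ∀ {i j} → Distant i j → 0 < point₀ i → 0 < point₀ j → ⊥
point₀-independent {0F}    {0F}    (i≢j , _) _ _ = i≢j refl
point₀-independent {suc _}         _ ()
point₀-independent {_}     {suc _} _ _ ()

point-admissible₀ : ∀ {a k} → Admissible a (suc k) → (∀ i → ¬ PositivePair a i) → 0 < a 0F →
                    Admissible (a ⊝ point₀) k
point-admissible₀ {a} adm no-pair a₀>0 =
  admissible-if-sum≤ (cancel-≤ (sum-⊝ point₀≤a) (sum≤-at-0F no-pair (triangle≤ adm) a₀>0))
  where
  point₀≤a : ∀ i → point₀ i ≤ a i
  point₀≤a 0F      = a₀>0
  point₀≤a (suc _) = z≤n

colour-point : ∀ {k} → (∀ {b} → Admissible b k → WeightedColouring Distant b k) →
               ∀ {a} j → Admissible a (suc k) → (∀ i → ¬ PositivePair a i) → 0 < a j →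
               WeightedColouring Distant a (suc k)
colour-point {k} colourable j adm no-pair aⱼ>0 =
  wlog-0F (λ b → WeightedColouring Distant b (suc k)) unrotate
          (λ b j → Admissible b (suc k) × (∀ i → ¬ PositivePair b i) × 0 < b j)
          (λ (adm , no-pair , b>0) → admissible-rotate adm , no-pair ∘ next7 , b>0)
          (λ (adm , no-pair , b₀>0) → extend point₀ point₀≤1 point₀-independent
                                        (colourable (point-admissible₀ adm no-pair b₀>0)))
          j (adm , no-pair , aⱼ>0)

admissible⇒colourable : ∀ k {a} → Admissible a k → WeightedColouring Distant a k
admissible⇒colourable zero {a} adm =
  emptyColouring (λ i → n≤0⇒n≡0 (≤-trans (weight≤triangleWeight a i) (triangle≤ adm i)))
admissible⇒colourable (suc k) {a} adm with any? (reduciblePair? (suc k) a)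
... | yes (j , red) = colour-pair (admissible⇒colourable k) j adm red
... | no  none with any? (λ i → 0 <? a i)
...   | yes (i , aᵢ>0) =
  colour-point (admissible⇒colourable k) i adm
               (no-positive-pair adm (λ j red → none (j , red))) aᵢ>0
...   | no  empty = emptyColouring (λ i → not-positive (λ aᵢ>0 → empty (i , aᵢ>0)))

-- The bound ⌊4ω/3⌋

ω≤⌊4ω/3⌋ : ∀ ω → ω ≤ 4 * ω / 3
ω≤⌊4ω/3⌋ ω = subst (_≤ 4 * ω / 3) (m*n/n≡m ω 3)
  (/-monoˡ-≤ 3 (subst (_≤ 4 * ω) (*-comm 3 ω) (*-monoˡ-≤ ω (n≤1+n 3))))

7ω<3[1+2⌊4ω/3⌋] : ∀ ω → 7 * ω < 3 * suc (4 * ω / 3 + 4 * ω / 3)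
7ω<3[1+2⌊4ω/3⌋] ω = begin-strict
  7 * ω                 ≡⟨ split ω ⟩
  4 * ω + 3 * ω         <⟨ +-mono-<-≤ 4ω<3+k*3 (*-monoʳ-≤ 3 (ω≤⌊4ω/3⌋ ω)) ⟩
  (3 + k * 3) + 3 * k   ≡⟨ merge k ⟩
  3 * suc (k + k)       ∎
  where
  open ≤-Reasoning
  k = 4 * ω / 3
  4ω<3+k*3 : 4 * ω < 3 + k * 3
  4ω<3+k*3 = subst (_< 3 + k * 3) (sym (m≡m%n+[m/n]*n (4 * ω) 3)) (+-monoˡ-< (k * 3) (m%n<n (4 * ω) 3))
  split : ∀ ω → 7 * ω ≡ 4 * ω + 3 * ω
  split = solve-∀
  merge : ∀ k → 3 + k * 3 + 3 * k ≡ 3 * suc (k + k)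
  merge = solve-∀

admissible-⌊4ω/3⌋ : ∀ {a ω} → (∀ j → triangleWeight a j ≤ ω) → Admissible a (4 * ω / 3)
admissible-⌊4ω/3⌋ {a} {ω} T≤ω = record
  { triangle≤ = λ j → ≤-trans (T≤ω j) (ω≤⌊4ω/3⌋ ω)
  ; sum≤      = s≤s⁻¹ (*-cancelˡ-< 3 _ _ (begin-strict
      3 * sum a               ≡⟨ sum-triangleWeight a ⟨
      sum (triangleWeight a)  ≤⟨ sum-mono-≤ T≤ω ⟩
      7 * ω                   <⟨ 7ω<3[1+2⌊4ω/3⌋] ω ⟩
      3 * suc (4 * ω / 3 + 4 * ω / 3) ∎))
  }
  where open ≤-Reasoning

module _ {G : Graph} {part : Fin (n G) → Fin 7} (H : IsHyperantihole7 G part) where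

  open IsHyperantihole7 H

  adjacent-parts-distant : ∀ {u v} → Adj G u v → part u ≢ part v → Distant (part u) (part v)
  adjacent-parts-distant {u} {v} uv pu≢pv =
    pu≢pv , (λ e → anticomplete u v e uv) , (λ e → anticomplete v u e (Graph.sym G uv))

  distant-parts-adjacent : ∀ {u v} → Distant (part u) (part v) → Adj G u v
  distant-parts-adjacent {u} {v} (pu≢pv , pv≢pu⁺ , pu≢pv⁺) = complete u v pu≢pv pv≢pu⁺ pu≢pv⁺

  private
    X : Fin 7 → Subset (n G)
    X = fibre _≟ᶠ_ part

  triangleClique : Fin 7 → Subset (n G)
  triangleClique j = (X (corner j 0F) ∪ X (corner j 1F)) ∪ X (corner j 2F)

  ∈-triangleClique⁻ : ∀ {j v} → v ∈ triangleClique j → ∃ λ c → part v ≡ corner j c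
  ∈-triangleClique⁻ {j} v∈ with x∈p∪q⁻ (X (corner j 0F) ∪ X (corner j 1F)) _ v∈
  ... | inj₂ v∈₂ = 2F , ∈-fibre⁻ _≟ᶠ_ part v∈₂
  ... | inj₁ v∈₀₁ with x∈p∪q⁻ (X (corner j 0F)) _ v∈₀₁
  ...   | inj₁ v∈₀ = 0F , ∈-fibre⁻ _≟ᶠ_ part v∈₀
  ...   | inj₂ v∈₁ = 1F , ∈-fibre⁻ _≟ᶠ_ part v∈₁

  triangleClique-isClique : ∀ j → IsClique G (triangleClique j)
  triangleClique-isClique j u v u∈ v∈ u≢v with ∈-triangleClique⁻ u∈ | ∈-triangleClique⁻ v∈
  ... | c , pu | c′ , pv with c ≟ᶠ c′
  ...   | yes refl = clique u v (trans pu (sym pv)) u≢v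
  ...   | no  c≢c′ = distant-parts-adjacent (subst₂ Distant (sym pu) (sym pv) (corners-distant j c c′ c≢c′))

  ∣triangleClique∣ : ∀ j → ∣ triangleClique j ∣ ≡ triangleWeight (partSize G _≟ᶠ_ part) j
  ∣triangleClique∣ j = begin
    ∣ (X c₀ ∪ X c₁) ∪ X c₂ ∣          ≡⟨ ∣p∪q∣≡∣p∣+∣q∣ (X c₀ ∪ X c₁) (X c₂) disjoint ⟩
    ∣ X c₀ ∪ X c₁ ∣ + ∣ X c₂ ∣        ≡⟨ cong (_+ ∣ X c₂ ∣) (∣p∪q∣≡∣p∣+∣q∣ (X c₀) (X c₁)
                                                 (fibres-disjoint _≟ᶠ_ part (corner≢ 0F 1F (λ ())))) ⟩
    ∣ X c₀ ∣ + ∣ X c₁ ∣ + ∣ X c₂ ∣    ≡⟨ +-assoc ∣ X c₀ ∣ _ _ ⟩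
    ∣ X c₀ ∣ + (∣ X c₁ ∣ + ∣ X c₂ ∣)  ≡⟨ cong (λ x → ∣ X c₀ ∣ + (∣ X c₁ ∣ + x)) (sym (+-identityʳ _)) ⟩
    triangleWeight (partSize G _≟ᶠ_ part) j ∎
    where
    open ≡-Reasoning
    c₀ c₁ c₂ : Fin 7
    c₀ = corner j 0F
    c₁ = corner j 1F
    c₂ = corner j 2F
    corner≢ : ∀ c c′ → c ≢ c′ → corner j c ≢ corner j c′
    corner≢ c c′ c≢c′ = proj₁ (corners-distant j c c′ c≢c′)
    disjoint : Empty ((X c₀ ∪ X c₁) ∩ X c₂)
    disjoint (v , v∈) with x∈p∩q⁻ (X c₀ ∪ X c₁) (X c₂) v∈
    ... | v∈₀₁ , v∈₂ with x∈p∪q⁻ (X c₀) (X c₁) v∈₀₁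
    ...   | inj₁ v∈₀ = fibres-disjoint _≟ᶠ_ part (corner≢ 0F 2F (λ ())) (v , x∈p∩q⁺ (v∈₀ , v∈₂))
    ...   | inj₂ v∈₁ = fibres-disjoint _≟ᶠ_ part (corner≢ 1F 2F (λ ())) (v , x∈p∩q⁺ (v∈₁ , v∈₂))

mainTheorem15 : (G : Graph) → Is7Hyperantihole G → (ω : ℕ) → IsCliqueNumber G ω
    → Colourable G ((4 * ω) / 3)
mainTheorem15 G (part , H) ω (_ , maximum) =
  blowup-colourable G _≟ᶠ_ part (adjacent-parts-distant H)
    (admissible⇒colourable (4 * ω / 3) (admissible-⌊4ω/3⌋ triangle≤ω))
  where
  triangle≤ω : ∀ j → triangleWeight (partSize G _≟ᶠ_ part) j ≤ ω
  triangle≤ω j = subst (_≤ ω) (∣triangleClique∣ H j) (maximum _ (triangleClique-isClique H j))
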